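{- For any connected digraph $D$ of order $n\ge3$, $L^t_2(D)\,L^t_2(D^{ -1})\le\frac{64n^2}{81}$.
   Context: Digraphs are finite, without loops or multiple arcs (opposite arcs allowed); connected means the underlying graph is connected. $D^{ -1}$ is the converse of $D$, obtained by reversing every arc. A vertex $u$ is adjacent with $v$ if $(u,v)$ or $(v,u)$ is an arc. A total $2$-limited packing is a set $B\subseteq V(D)$ such that every vertex in $B$ is adjacent with at most one vertex of $B$ and every vertex in $V(D)\setminus B$ has at most two out-neighbours in $B$; $L^t_2(D)$ is its maximum size. -}

module Defs where

open import Data.Nat using (ℕ; zero; suc; _+_; _≤_)
open import Data.Bool using (Bool; true; false; _∨_; _∧_; not; if_then_else_)
open import Data.Fin using (Fin; zero; suc)
open import Relation.Binary.PropositionalEquality using (_≡_)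
open import Data.Product using (Σ; _×_)

-- A digraph of order n on vertex set Fin n: arc u v = true iff (u,v) is an arc.
-- No loops; opposite arcs allowed; no multiple arcs (arcs form a relation).
record Digraph (n : ℕ) : Set where
  field
    arc     : Fin n → Fin n → Bool
    loopless : ∀ v → arc v v ≡ false
open Digraph public

converse : ∀ {n} → Digraph n → Digraph n
converse D = record { arc = λ u v → arc D v u ; loopless = loopless D }

adj : ∀ {n} → Digraph n → Fin n → Fin n → Bool
adj D u v = arc D u v ∨ arc D v u

data Reach {n : ℕ} (D : Digraph n) : Fin n → Fin n → Set where
  here : ∀ {u} → Reach D u u
  step : ∀ {u v w} → adj D u v ≡ true → Reach D v w → Reach D u w

Connected : ∀ {n} → Digraph n → Set
Connected {n} D = ∀ (u v : Fin n) → Reach D u v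

count : ∀ {n} → (Fin n → Bool) → ℕ
count {zero}  f = 0
count {suc n} f = (if f zero then 1 else 0) + count {n} (λ i → f (suc i))

VSet : ℕ → Set
VSet n = Fin n → Bool

size : ∀ {n} → VSet n → ℕ
size B = count B

IsTotal2LimitedPacking : ∀ {n} → Digraph n → VSet n → Set
IsTotal2LimitedPacking {n} D B =
  (∀ (u : Fin n) → B u ≡ true → count (λ w → B w ∧ adj D u w) ≤ 1) ×
  (∀ (v : Fin n) → B v ≡ false → count (λ w → B w ∧ arc D v w) ≤ 2)

IsLt2 : ∀ {n} → Digraph n → ℕ → Set
IsLt2 {n} D k =
  Σ (VSet n) (λ B → IsTotal2LimitedPacking D B × (size B ≡ k)) ×
  (∀ (B : VSet n) → IsTotal2LimitedPacking D B → size B ≤ k)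

-- Let B₁, B₂ be total 2-limited packings of D and D⁻¹, and split the vertices into
-- none = V ∖ (B₁ ∪ B₂), only₁ = B₁ ∖ B₂, only₂ = B₂ ∖ B₁ and both = B₁ ∩ B₂.
-- A vertex of both is exposed if it has a neighbour outside B₁, sheltered otherwise.
-- A vertex of none is adjacent to at most 2 + 2 vertices of both (out-arcs into B₁,
-- in-arcs from B₂), and a vertex of only₂ to at most one vertex of B₂; hence
-- |exposed| ≤ 4|none| + |only₂|. A sheltered vertex v is the only B₁-neighbour of
-- some exposed vertex or some vertex of only₁: otherwise every neighbour of v would be
-- sheltered with v as its only neighbour in B₁, so v and its (at most one) neighbour
-- would form a component, impossible for a connected digraph with n ≥ 3. Hence
-- |sheltered| ≤ |exposed| + |only₁|, so |both| ≤ 8|none| + 2|only₂| + |only₁|, which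
-- rearranges to 9(|B₁| + |B₂|) ≤ 16n; AM–GM then bounds |B₁||B₂|.
module Submission where

open import Defs
open import Data.Nat.Base using (ℕ; zero; suc; _+_; _*_; _≤_; z≤n; s≤s)
open import Data.Nat.Properties hiding (_≟_)
open import Data.Nat.Tactic.RingSolver using (solve)
open import Algebra.Properties.CommutativeSemigroup +-commutativeSemigroup
  using () renaming (interchange to +-interchange)
open import Data.Bool.Base using (Bool; true; false; _∧_; _∨_; not; if_then_else_)
open import Data.Bool.Properties using (∧-comm; ∨-comm; ∨-zeroʳ; ¬-not; not-involutive)
import Data.Bool.Properties as Bool
open import Data.Fin.Base using (Fin; zero; suc)
open import Data.Fin.Properties using (_≟_; any?)
open import Data.List.Base using (_∷_; [])
open import Data.Product.Base using (∃; _×_; _,_; proj₁; proj₂)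
open import Data.Sum.Base using (_⊎_; inj₁; inj₂)
open import Data.Empty using (⊥-elim)
open import Function.Base using (_∘_; case_of_)
open import Relation.Nullary using (does; yes; no)
open import Relation.Nullary.Decidable using (dec-true)
open import Relation.Binary.PropositionalEquality

4mn≤[m+n]²-ordered : ∀ {m n} → m ≤ n → 4 * (m * n) ≤ (m + n) * (m + n)
4mn≤[m+n]²-ordered {m} m≤n with m≤n⇒∃[o]m+o≡n m≤n
... | d , refl = begin
  4 * (m * (m + d))               ≤⟨ m≤m+n _ (d * d) ⟩
  4 * (m * (m + d)) + d * d       ≡⟨ solve (m ∷ d ∷ []) ⟩
  (m + (m + d)) * (m + (m + d))   ∎
  where open ≤-Reasoning

4mn≤[m+n]² : ∀ m n → 4 * (m * n) ≤ (m + n) * (m + n)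
4mn≤[m+n]² m n with ≤-total m n
... | inj₁ m≤n = 4mn≤[m+n]²-ordered m≤n
... | inj₂ n≤m =
  subst₂ (λ a b → 4 * a ≤ b * b) (*-comm n m) (+-comm n m) (4mn≤[m+n]²-ordered n≤m)

product-bound : ∀ n k₁ k₂ → 9 * (k₁ + k₂) ≤ 16 * n → 81 * (k₁ * k₂) ≤ 64 * (n * n)
product-bound n k₁ k₂ sum≤ = *-cancelˡ-≤ 4 (begin
  4 * (81 * (k₁ * k₂))                ≡⟨ solve (k₁ ∷ k₂ ∷ []) ⟩
  81 * (4 * (k₁ * k₂))                ≤⟨ *-monoʳ-≤ 81 (4mn≤[m+n]² k₁ k₂) ⟩
  81 * ((k₁ + k₂) * (k₁ + k₂))        ≡⟨ solve (k₁ ∷ k₂ ∷ []) ⟩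
  (9 * (k₁ + k₂)) * (9 * (k₁ + k₂))   ≤⟨ *-mono-≤ sum≤ sum≤ ⟩
  (16 * n) * (16 * n)                 ≡⟨ solve (n ∷ []) ⟩
  4 * (64 * (n * n))                  ∎)
  where open ≤-Reasoning

sum-bound : ∀ a b c d → d ≤ 8 * a + 2 * b + c →
            9 * ((d + c) + (d + b)) ≤ 16 * ((d + c) + (b + a))
sum-bound a b c d d≤ = begin
  9 * ((d + c) + (d + b))
    ≡⟨ solve (b ∷ c ∷ d ∷ []) ⟩
  16 * d + 9 * (b + c) + 2 * d
    ≤⟨ +-monoʳ-≤ (16 * d + 9 * (b + c)) (*-monoʳ-≤ 2 d≤) ⟩
  16 * d + 9 * (b + c) + 2 * (8 * a + 2 * b + c)
    ≤⟨ m≤m+n _ (3 * b + 5 * c) ⟩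
  16 * d + 9 * (b + c) + 2 * (8 * a + 2 * b + c) + (3 * b + 5 * c)
    ≡⟨ solve (a ∷ b ∷ c ∷ d ∷ []) ⟩
  16 * ((d + c) + (b + a))
    ∎
  where open ≤-Reasoning

count-false : ∀ {n} → count {n} (λ _ → false) ≡ 0
count-false {zero}  = refl
count-false {suc n} = count-false {n}

count-true : ∀ {n} → count {n} (λ _ → true) ≡ n
count-true {zero}  = refl
count-true {suc n} = cong suc (count-true {n})

count-cong : ∀ {n} {f g : VSet n} → (∀ i → f i ≡ g i) → count f ≡ count g
count-cong {zero}  f≗g = refl
count-cong {suc n} f≗g =
  cong₂ _+_ (cong (λ b → if b then 1 else 0) (f≗g zero)) (count-cong (f≗g ∘ suc))

count-mono : ∀ {n} {f g : VSet n} → (∀ i → f i ≡ true → g i ≡ true) → count f ≤ count g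
count-mono {zero} f⊆g = z≤n
count-mono {suc n} {f} {g} f⊆g with f zero in f₀ | g zero in g₀
... | true  | true  = s≤s (count-mono (f⊆g ∘ suc))
... | true  | false with () ← trans (sym (f⊆g zero f₀)) g₀
... | false | true  = m≤n⇒m≤1+n (count-mono (f⊆g ∘ suc))
... | false | false = count-mono (f⊆g ∘ suc)

count-all : ∀ {n} {f : VSet n} → (∀ i → f i ≡ true) → n ≤ count f
count-all {n} {f} all = subst (_≤ count f) (count-true {n}) (count-mono (λ i _ → all i))

count-∨ : ∀ {n} (f g : VSet n) → count (λ i → f i ∨ g i) ≤ count f + count g
count-∨ {zero}  f g = z≤n
count-∨ {suc n} f g with f zero | g zero
... | true  | true  =
  s≤s (≤-trans (count-∨ (f ∘ suc) (g ∘ suc)) (+-monoʳ-≤ (count (f ∘ suc)) (n≤1+n _)))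
... | true  | false = s≤s (count-∨ (f ∘ suc) (g ∘ suc))
... | false | true  = ≤-trans (s≤s (count-∨ (f ∘ suc) (g ∘ suc))) (≤-reflexive (sym (+-suc _ _)))
... | false | false = count-∨ (f ∘ suc) (g ∘ suc)

count-partition : ∀ {n} (f g : VSet n) →
                  count f ≡ count (λ i → f i ∧ g i) + count (λ i → f i ∧ not (g i))
count-partition {zero}  f g = refl
count-partition {suc n} f g with f zero | g zero
... | true  | true  = cong suc (count-partition (f ∘ suc) (g ∘ suc))
... | true  | false = trans (cong suc (count-partition (f ∘ suc) (g ∘ suc))) (sym (+-suc _ _))
... | false | _     = count-partition (f ∘ suc) (g ∘ suc)

1≤count : ∀ {n} {f : VSet n} {i} → f i ≡ true → 1 ≤ count f
1≤count {f = f} {zero}  fi rewrite fi = s≤s z≤n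
1≤count {f = f} {suc i} fi with f zero
... | true  = s≤s z≤n
... | false = 1≤count {f = f ∘ suc} fi

count≤1⇒unique : ∀ {n} {f : VSet n} → count f ≤ 1 →
                 ∀ {i j} → f i ≡ true → f j ≡ true → i ≡ j
count≤1⇒unique         c≤1 {zero}  {zero}  fi fj = refl
count≤1⇒unique {f = f} c≤1 {zero}  {suc j} fi fj rewrite fi =
  ⊥-elim (≤⇒≯ (≤-pred c≤1) (1≤count {f = f ∘ suc} fj))
count≤1⇒unique {f = f} c≤1 {suc i} {zero}  fi fj rewrite fj =
  ⊥-elim (≤⇒≯ (≤-pred c≤1) (1≤count {f = f ∘ suc} fi))
count≤1⇒unique {f = f} c≤1 {suc i} {suc j} fi fj with f zero
... | true  = ⊥-elim (≤⇒≯ (≤-pred c≤1) (1≤count {f = f ∘ suc} fi))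
... | false = cong suc (count≤1⇒unique {f = f ∘ suc} c≤1 fi fj)

count-≟ : ∀ {n} (v : Fin n) → count (λ w → does (w ≟ v)) ≤ 1
count-≟ {suc n} zero    = s≤s (≤-reflexive (count-false {n}))
count-≟ {suc n} (suc v) = count-≟ v

∧≡true⇒ : ∀ {a b : Bool} → a ∧ b ≡ true → a ≡ true × b ≡ true
∧≡true⇒ {true} {true} _ = refl , refl

∑ : ∀ {n} → (Fin n → ℕ) → ℕ
∑ {zero}  w = 0
∑ {suc n} w = w zero + ∑ (w ∘ suc)

∑-mono : ∀ {n} {v w : Fin n → ℕ} → (∀ i → v i ≤ w i) → ∑ v ≤ ∑ w
∑-mono {zero}  v≤w = z≤n
∑-mono {suc n} v≤w = +-mono-≤ (v≤w zero) (∑-mono (v≤w ∘ suc))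

∑-+ : ∀ {n} (v w : Fin n → ℕ) → ∑ (λ i → v i + w i) ≡ ∑ v + ∑ w
∑-+ {zero}  v w = refl
∑-+ {suc n} v w = trans (cong (v zero + w zero +_) (∑-+ (v ∘ suc) (w ∘ suc)))
                        (+-interchange (v zero) (w zero) (∑ (v ∘ suc)) (∑ (w ∘ suc)))

∑-if : ∀ {n} (c : ℕ) (f : VSet n) → ∑ (λ i → if f i then c else 0) ≡ c * count f
∑-if {zero}  c f = sym (*-zeroʳ c)
∑-if {suc n} c f with f zero
... | true  = trans (cong (c +_) (∑-if c (f ∘ suc))) (sym (*-suc c _))
... | false = ∑-if c (f ∘ suc)

count-cover : ∀ {k n} (R : Fin k → VSet n) {f : VSet n} →
              (∀ v → f v ≡ true → ∃ λ u → R u v ≡ true) → count f ≤ ∑ (λ u → count (R u))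
count-cover {zero} {n} R {f} cover =
  ≤-reflexive (trans (count-cong {g = λ _ → false} nowhere) (count-false {n}))
  where
  nowhere : ∀ v → f v ≡ false
  nowhere v = ¬-not (λ fv → case cover v fv of λ ())
count-cover {suc k} R {f} cover = begin
  count f
    ≤⟨ count-mono split ⟩
  count (λ v → R zero v ∨ (f v ∧ not (R zero v)))
    ≤⟨ count-∨ (R zero) _ ⟩
  count (R zero) + count (λ v → f v ∧ not (R zero v))
    ≤⟨ +-monoʳ-≤ (count (R zero)) (count-cover (R ∘ suc) rest) ⟩
  count (R zero) + ∑ (λ u → count (R (suc u)))
    ∎
  where
  open ≤-Reasoning
  split : ∀ v → f v ≡ true → R zero v ∨ (f v ∧ not (R zero v)) ≡ true
  split v fv rewrite fv with R zero v
  ... | true  = refl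
  ... | false = refl
  rest : ∀ v → f v ∧ not (R zero v) ≡ true → ∃ λ u → R (suc u) v ≡ true
  rest v e with ∧≡true⇒ e
  ... | fv , ¬r with cover v fv
  ...   | suc u , r = u , r
  ...   | zero  , r with () ← trans (cong not (sym r)) ¬r

any : ∀ {n} → VSet n → Bool
any P = does (any? (λ i → P i Bool.≟ true))

any-witness : ∀ {n} {P : VSet n} → any P ≡ true → ∃ λ i → P i ≡ true
any-witness {P = P} holds with any? (λ i → P i Bool.≟ true)
... | yes w = w

any≡false : ∀ {n} {P : VSet n} → any P ≡ false → ∀ i → P i ≡ false
any≡false {P = P} fails i with any? (λ i → P i Bool.≟ true)
... | no ¬w = ¬-not (λ Pi → ¬w (i , Pi))

adj-sym : ∀ {n} (D : Digraph n) u v → adj D u v ≡ adj D v u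
adj-sym D u v = ∨-comm (arc D u v) (arc D v u)

Reach-closed : ∀ {n} {D : Digraph n} (K : Fin n → Set) →
               (∀ {u w} → K u → adj D u w ≡ true → K w) →
               ∀ {u w} → Reach D u w → K u → K w
Reach-closed K closed here       Ku = Ku
Reach-closed K closed (step a r) Ku = Reach-closed K closed r (closed Ku a)

order≤1+degree : ∀ {n} {D : Digraph n} → Connected D → ∀ v →
                 (∀ {u w} → adj D v u ≡ true → adj D u w ≡ true → w ≡ v) →
                 n ≤ 1 + count (adj D v)
order≤1+degree {n} {D} connected v beyond-is-v = begin
  n
    ≤⟨ count-all (λ w → near⇒counted (Reach-closed Near near-closed (connected v w) (inj₁ refl))) ⟩
  count (λ w → does (w ≟ v) ∨ adj D v w)
    ≤⟨ count-∨ (λ w → does (w ≟ v)) (adj D v) ⟩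
  count (λ w → does (w ≟ v)) + count (adj D v)
    ≤⟨ +-monoˡ-≤ (count (adj D v)) (count-≟ v) ⟩
  1 + count (adj D v)
    ∎
  where
  open ≤-Reasoning
  Near : Fin n → Set
  Near w = w ≡ v ⊎ adj D v w ≡ true
  near-closed : ∀ {u w} → Near u → adj D u w ≡ true → Near w
  near-closed (inj₁ refl) vw = inj₂ vw
  near-closed (inj₂ vu)   uw = inj₁ (beyond-is-v vu uw)
  near⇒counted : ∀ {w} → Near w → does (w ≟ v) ∨ adj D v w ≡ true
  near⇒counted     (inj₁ refl) = cong (_∨ adj D v v) (dec-true (v ≟ v) refl)
  near⇒counted {w} (inj₂ vw)   = trans (cong (does (w ≟ v) ∨_) vw) (∨-zeroʳ _)

packing-unique-neighbour : ∀ {n} {D : Digraph n} {B : VSet n} → IsTotal2LimitedPacking D B →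
                           ∀ {u w₁ w₂} → B u ≡ true →
                           B w₁ ∧ adj D u w₁ ≡ true → B w₂ ∧ adj D u w₂ ≡ true → w₁ ≡ w₂
packing-unique-neighbour (few-neighbours , _) Bu = count≤1⇒unique (few-neighbours _ Bu)

module Packings {n} (D : Digraph n) {B₁ B₂ : VSet n}
  (P₁ : IsTotal2LimitedPacking D B₁) (P₂ : IsTotal2LimitedPacking (converse D) B₂) where

  none only₁ only₂ both : VSet n
  none  v = not (B₁ v) ∧ not (B₂ v)
  only₁ v = B₁ v ∧ not (B₂ v)
  only₂ v = not (B₁ v) ∧ B₂ v
  both  v = B₁ v ∧ B₂ v

  hasOuterNeighbour : VSet n
  hasOuterNeighbour v = any (λ x → not (B₁ x) ∧ adj D x v)

  exposed sheltered : VSet n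
  exposed   v = both v ∧ hasOuterNeighbour v
  sheltered v = both v ∧ not (hasOuterNeighbour v)

  guards : Fin n → VSet n
  guards p v = (exposed p ∨ only₁ p) ∧ (B₁ v ∧ adj D p v)

  size-B₁ : size B₁ ≡ count both + count only₁
  size-B₁ = count-partition B₁ B₂

  size-B₂ : size B₂ ≡ count both + count only₂
  size-B₂ = trans (count-partition B₂ B₁)
    (cong₂ _+_ (count-cong (λ v → ∧-comm (B₂ v) (B₁ v)))
               (count-cong (λ v → ∧-comm (B₂ v) (not (B₁ v)))))

  order : n ≡ (count both + count only₁) + (count only₂ + count none)
  order = begin
    n
      ≡⟨ sym (count-true {n}) ⟩
    count {n} (λ _ → true)
      ≡⟨ count-partition (λ _ → true) B₁ ⟩
    count B₁ + count (λ v → not (B₁ v))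
      ≡⟨ cong₂ _+_ size-B₁ (count-partition (λ v → not (B₁ v)) B₂) ⟩
    (count both + count only₁) + (count only₂ + count none)
      ∎
    where open ≡-Reasoning

  count-exposed : count exposed ≤ 4 * count none + count only₂
  count-exposed = begin
    count exposed
      ≤⟨ count-cover exposes exposer ⟩
    ∑ (λ x → count (exposes x))
      ≤⟨ ∑-mono exposes-few ⟩
    ∑ (λ x → (if none x then 4 else 0) + (if only₂ x then 1 else 0))
      ≡⟨ ∑-+ (λ x → if none x then 4 else 0) (λ x → if only₂ x then 1 else 0) ⟩
    ∑ (λ x → if none x then 4 else 0) + ∑ (λ x → if only₂ x then 1 else 0)
      ≡⟨ cong₂ _+_ (∑-if 4 none) (trans (∑-if 1 only₂) (*-identityˡ _)) ⟩
    4 * count none + count only₂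
      ∎
    where
    open ≤-Reasoning
    exposes : Fin n → VSet n
    exposes x v = (not (B₁ x) ∧ adj D x v) ∧ both v
    exposer : ∀ v → exposed v ≡ true → ∃ λ x → exposes x v ≡ true
    exposer v e with ∧≡true⇒ e
    ... | both-v , outer with any-witness outer
    ...   | x , x-outer = x , cong₂ _∧_ x-outer both-v
    out-into-B₁-or-in-from-B₂ : ∀ p q a b →
                                (p ∨ q) ∧ (a ∧ b) ≡ true → (a ∧ p) ∨ (b ∧ q) ≡ true
    out-into-B₁-or-in-from-B₂ true  _    true true _ = refl
    out-into-B₁-or-in-from-B₂ false true true true _ = refl
    adjacent-in-B₂ : ∀ p q a b → (p ∨ q) ∧ (a ∧ b) ≡ true → b ∧ (q ∨ p) ≡ true
    adjacent-in-B₂ true  q    true true _ = ∨-zeroʳ q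
    adjacent-in-B₂ false true true true _ = refl
    exposes-few : ∀ x →
                  count (exposes x) ≤ (if none x then 4 else 0) + (if only₂ x then 1 else 0)
    exposes-few x with B₁ x in B₁x | B₂ x in B₂x
    ... | true  | _     = ≤-reflexive (count-false {n})
    ... | false | false = begin
      count (λ v → adj D x v ∧ both v)
        ≤⟨ count-mono (λ v → out-into-B₁-or-in-from-B₂ (arc D x v) (arc D v x) (B₁ v) (B₂ v)) ⟩
      count (λ v → (B₁ v ∧ arc D x v) ∨ (B₂ v ∧ arc D v x))
        ≤⟨ count-∨ (λ v → B₁ v ∧ arc D x v) (λ v → B₂ v ∧ arc D v x) ⟩
      count (λ v → B₁ v ∧ arc D x v) + count (λ v → B₂ v ∧ arc D v x)
        ≤⟨ +-mono-≤ (proj₂ P₁ x B₁x) (proj₂ P₂ x B₂x) ⟩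
      4
        ∎
    ... | false | true  =
      ≤-trans (count-mono (λ v → adjacent-in-B₂ (arc D x v) (arc D v x) (B₁ v) (B₂ v)))
              (proj₁ P₂ x B₂x)

  no-outer-neighbour : ∀ {v} → sheltered v ≡ true → hasOuterNeighbour v ≡ false
  no-outer-neighbour {v} sh =
    trans (sym (not-involutive (hasOuterNeighbour v))) (cong not (proj₂ (∧≡true⇒ sh)))

  sheltered⇒neighbours-in-B₁ : ∀ {v x} → sheltered v ≡ true → adj D x v ≡ true → B₁ x ≡ true
  sheltered⇒neighbours-in-B₁ {v} {x} sh a with B₁ x in B₁x
  ... | true  = refl
  ... | false with () ← trans (sym (any≡false (no-outer-neighbour sh) x))
                              (trans (cong (λ b → not b ∧ adj D x v) B₁x) a)

  unguarded⇒sheltered : ∀ {u v} → B₁ u ≡ true → B₁ v ≡ true → adj D u v ≡ true →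
                        guards u v ≡ false → sheltered u ≡ true
  unguarded⇒sheltered {u} {v} = helper (B₂ u) (hasOuterNeighbour u)
    where
    helper : ∀ {b₁u b₁v a} b₂u h → b₁u ≡ true → b₁v ≡ true → a ≡ true →
             ((b₁u ∧ b₂u) ∧ h ∨ b₁u ∧ not b₂u) ∧ (b₁v ∧ a) ≡ false → (b₁u ∧ b₂u) ∧ not h ≡ true
    helper true  false refl refl refl _  = refl
    helper true  true  refl refl refl ()
    helper false _     refl refl refl ()

  module _ (3≤n : 3 ≤ n) (connected : Connected D) where

    sheltered⇒guarded : ∀ {v} → sheltered v ≡ true → ∃ λ p → guards p v ≡ true
    sheltered⇒guarded {v} sh with any? (λ p → guards p v Bool.≟ true)
    ... | yes guarded  = guarded
    ... | no unguarded = ⊥-elim (≤⇒≯ n≤2 3≤n)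
      where
      B₁v : B₁ v ≡ true
      B₁v = proj₁ (∧≡true⇒ (proj₁ (∧≡true⇒ sh)))
      neighbour-in-B₁ : ∀ {w} → adj D v w ≡ true → B₁ w ≡ true
      neighbour-in-B₁ {w} a = sheltered⇒neighbours-in-B₁ sh (trans (adj-sym D w v) a)
      neighbour-sheltered : ∀ {u} → adj D v u ≡ true → sheltered u ≡ true
      neighbour-sheltered {u} a = unguarded⇒sheltered (neighbour-in-B₁ a) B₁v
        (trans (adj-sym D u v) a) (¬-not (λ g → unguarded (u , g)))
      -- u is sheltered, so w lies in B₁, where u has no neighbour besides v.
      only-v-beyond : ∀ {u w} → adj D v u ≡ true → adj D u w ≡ true → w ≡ v
      only-v-beyond {u} {w} vu uw = packing-unique-neighbour {D = D} P₁ (neighbour-in-B₁ vu)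
        (cong₂ _∧_ (sheltered⇒neighbours-in-B₁ (neighbour-sheltered vu) (trans (adj-sym D w u) uw))
                   uw)
        (cong₂ _∧_ B₁v (trans (adj-sym D u v) vu))
      n≤2 : n ≤ 2
      n≤2 = begin
        n
          ≤⟨ order≤1+degree connected v only-v-beyond ⟩
        1 + count (adj D v)
          ≤⟨ +-monoʳ-≤ 1 (count-mono {g = λ w → B₁ w ∧ adj D v w}
                                     (λ w a → cong₂ _∧_ (neighbour-in-B₁ a) a)) ⟩
        1 + count (λ w → B₁ w ∧ adj D v w)
          ≤⟨ +-monoʳ-≤ 1 (proj₁ P₁ v B₁v) ⟩
        2
          ∎
        where open ≤-Reasoning

    count-sheltered : count sheltered ≤ count exposed + count only₁
    count-sheltered = begin
      count sheltered
        ≤⟨ count-cover guards (λ _ → sheltered⇒guarded) ⟩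
      ∑ (λ p → count (guards p))
        ≤⟨ ∑-mono guards-few ⟩
      ∑ (λ p → if exposed p ∨ only₁ p then 1 else 0)
        ≡⟨ ∑-if 1 (λ p → exposed p ∨ only₁ p) ⟩
      1 * count (λ p → exposed p ∨ only₁ p)
        ≡⟨ *-identityˡ _ ⟩
      count (λ p → exposed p ∨ only₁ p)
        ≤⟨ count-∨ exposed only₁ ⟩
      count exposed + count only₁
        ∎
      where
      open ≤-Reasoning
      guard-in-B₁ : ∀ {p} → exposed p ∨ only₁ p ≡ true → B₁ p ≡ true
      guard-in-B₁ {p} g with B₁ p
      ... | true = refl
      guards-few : ∀ p → count (guards p) ≤ (if exposed p ∨ only₁ p then 1 else 0)
      guards-few p with exposed p ∨ only₁ p in g
      ... | true  = proj₁ P₁ p (guard-in-B₁ g)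
      ... | false = ≤-reflexive (count-false {n})

    count-both : count both ≤ 8 * count none + 2 * count only₂ + count only₁
    count-both = begin
      count both
        ≡⟨ count-partition both hasOuterNeighbour ⟩
      count exposed + count sheltered
        ≤⟨ +-monoʳ-≤ (count exposed) count-sheltered ⟩
      count exposed + (count exposed + count only₁)
        ≤⟨ +-mono-≤ count-exposed (+-monoˡ-≤ (count only₁) count-exposed) ⟩
      (4 * count none + count only₂) + ((4 * count none + count only₂) + count only₁)
        ≡⟨ regroup (count none) (count only₂) (count only₁) ⟩
      8 * count none + 2 * count only₂ + count only₁
        ∎
      where
      open ≤-Reasoning
      regroup : ∀ a b c → (4 * a + b) + ((4 * a + b) + c) ≡ 8 * a + 2 * b + c
      regroup a b c = solve (a ∷ b ∷ c ∷ [])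

    sizes-bound : 9 * (size B₁ + size B₂) ≤ 16 * n
    sizes-bound = subst₂ (λ s m → 9 * s ≤ 16 * m) (sym (cong₂ _+_ size-B₁ size-B₂)) (sym order)
      (sum-bound (count none) (count only₂) (count only₁) (count both) count-both)

corollary2 : ∀ (n : ℕ) → 3 ≤ n → (D : Digraph n) → Connected D →
    ∀ (k₁ k₂ : ℕ) → IsLt2 D k₁ → IsLt2 (converse D) k₂ →
    81 * (k₁ * k₂) ≤ 64 * (n * n)
corollary2 n 3≤n D connected k₁ k₂ ((B₁ , P₁ , refl) , _) ((B₂ , P₂ , refl) , _) =
  product-bound n (size B₁) (size B₂) (Packings.sizes-bound D P₁ P₂ 3≤n connected)
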